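{- Let $n\ge 3$ and let $A=[a_{ij}]_{i,j=1}^{n-1}$ be a real $(n-1)\times(n-1)$ matrix with zero diagonal, with LOP function $f_A(\sigma)=\sum_{k<l} a_{\sigma(k)\sigma(l)}$ on $\Sigma_{n-1}$. Let $A'=[a_{ij}]_{i,j=1}^{n}$ be the $n\times n$ matrix extending $A$ by $$a_{in}=-\sum_{j=1}^{n-1}(a_{ij}-a_{ji})\quad (i=1,\dots,n-1),\qquad a_{ni}=0\quad (i=1,\dots,n),$$ with LOP function $f_{A'}$ on $\Sigma_n$. Then for any $[i_1\ i_2\ \cdots\ i_{n-1}]\in\Sigma_{n-1}$, the permutation $[i_1\ i_2\ \cdots\ i_{n-1}\ n]$ is a global maximizer of $f_{A'}$ if and only if $[i_1\ i_2\ \cdots\ i_{n-1}]$ is a global maximizer of $f_A$.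
   Context: $\Sigma_m$ is the set of permutations of $\{1,\dots,m\}$, written $[\sigma(1)\ \cdots\ \sigma(m)]$ with $\sigma(k)$ the row/column index in position $k$; the LOP function of an $m\times m$ matrix $B$ is $f_B(\sigma)=\sum_{k=1}^{m-1}\sum_{l=k+1}^{m} b_{\sigma(k)\sigma(l)}$, and "global optimum" means global maximizer. -}

module Defs where

open import Level using (Level; _⊔_)
open import Data.Nat.Base using (ℕ; zero; suc)
open import Data.Fin.Base using (Fin; zero; suc)
open import Data.Fin.Properties using (_<?_)
open import Data.Maybe.Base using (Maybe; just; nothing)
import Data.Maybe.Base as Maybe
open import Data.Bool.Base using (if_then_else_)
open import Relation.Nullary.Decidable using (⌊_⌋)
open import Relation.Binary.Core using (Rel)
open import Relation.Binary.Structures using (IsTotalOrder)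
open import Algebra.Bundles using (CommutativeRing)
open import Data.Fin.Permutation using (Permutation′; _⟨$⟩ʳ_)
import Algebra.Definitions.RawMonoid as RawMonoidDefs

-- The paper works over ℝ; the standard library has no reals, so the statement
-- is made for every ordered commutative ring.
record OrderedCommutativeRing (c ℓ₁ ℓ₂ : Level) : Set (Level.suc (c ⊔ ℓ₁ ⊔ ℓ₂)) where
  field
    commutativeRing : CommutativeRing c ℓ₁
  open CommutativeRing commutativeRing public
  infix 4 _≤_
  field
    _≤_          : Rel Carrier ℓ₂
    isTotalOrder : IsTotalOrder _≈_ _≤_
    +-monoˡ-≤    : ∀ z {x y} → x ≤ y → x + z ≤ y + z
    *-nonneg     : ∀ {x y} → 0# ≤ x → 0# ≤ y → 0# ≤ x * y

module LOP {c ℓ₁ ℓ₂} (R : OrderedCommutativeRing c ℓ₁ ℓ₂) where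
  open OrderedCommutativeRing R using (Carrier; _+_; _-_; -_; 0#; _≤_; +-rawMonoid)

  ∑ : ∀ {m} → (Fin m → Carrier) → Carrier
  ∑ = RawMonoidDefs.sum +-rawMonoid

  Matrix : ℕ → Set c
  Matrix m = Fin m → Fin m → Carrier

  lopFun : ∀ {m} → Matrix m → Permutation′ m → Carrier
  lopFun B σ = ∑ λ k → ∑ λ l →
    if ⌊ k <? l ⌋ then B (σ ⟨$⟩ʳ k) (σ ⟨$⟩ʳ l) else 0#

  IsGlobalMax : ∀ {m} → (Permutation′ m → Carrier) → Permutation′ m → Set ℓ₂
  IsGlobalMax f σ = ∀ τ → f τ ≤ f σ

  -- Fin (suc m) = {old indices} ∪ {last}: nothing exactly for the last index m
  toOld : ∀ {m} → Fin (suc m) → Maybe (Fin m)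
  toOld {zero}  zero    = nothing
  toOld {suc m} zero    = just zero
  toOld {suc m} (suc i) = Maybe.map suc (toOld i)

  extendEntry : ∀ {m} → Matrix m → Maybe (Fin m) → Maybe (Fin m) → Carrier
  extendEntry A (just i) (just j) = A i j
  extendEntry A (just i) nothing  = - ∑ (λ j → A i j - A j i)
  extendEntry A nothing  _        = 0#

  extend : ∀ {m} → Matrix m → Matrix (suc m)
  extend A i j = extendEntry A (toOld i) (toOld j)

{-# OPTIONS --safe #-}
module Submission where

-- A matrix is balanced when every row sum equals the corresponding column sum.
-- Moving the first element of an ordering to the end changes the LOP value by
-- (column sum − row sum) of that element, so for a balanced matrix the LOP
-- function is invariant under cyclic rotation, and every ordering has a rotation
-- ending in any prescribed element.  The new column of A' is chosen exactly so
-- that A' is balanced; its entries sum to zero, so an ordering ending in n has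
-- the same value under A' as the ordering of the first n − 1 indices under A.
-- Hence the maxima agree.

open import Defs
open import Data.Nat.Base using (ℕ; _≤_)
open import Data.Fin.Base using (Fin; fromℕ)
open import Data.Fin.Permutation using (Permutation′; insert)
open import Function.Bundles using (_⇔_)

import Data.Nat.Base as Nat
import Data.Nat.Properties as Natₚ
open import Data.Fin.Base using (zero; suc; inject₁; toℕ; punchIn)
import Data.Fin.Properties as Finₚ
open import Data.Fin.Properties using (_<?_)
open import Data.Fin.Relation.Unary.Top using (view; ‵fromℕ; ‵inject₁)
open import Data.Fin.Permutation as Perm using (_⟨$⟩ʳ_; _⟨$⟩ˡ_; _∘ₚ_; remove)
open import Data.Maybe.Base using (nothing)
import Data.Maybe.Base as Maybe
open import Data.Bool.Base using (if_then_else_)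
open import Data.Product using (∃; _,_; map₂)
open import Data.Empty using (⊥-elim)
open import Relation.Nullary using (¬_; yes; no)
open import Relation.Nullary.Decidable using (⌊_⌋)
open import Relation.Binary.PropositionalEquality as ≡ using (_≡_)
open import Relation.Binary.Structures using (IsTotalOrder)
open import Function.Bundles using (mk⇔)

punchIn-fromℕ : ∀ {n} (k : Fin n) → punchIn (fromℕ n) k ≡ inject₁ k
punchIn-fromℕ zero    = ≡.refl
punchIn-fromℕ (suc k) = ≡.cong suc (punchIn-fromℕ k)

insert-self : ∀ {m} (i j : Fin (Nat.suc m)) (π : Permutation′ m) →
              insert i j π ⟨$⟩ʳ i ≡ j
insert-self i j π with i Finₚ.≟ i
... | yes _  = ≡.refl
... | no i≢i = ⊥-elim (i≢i ≡.refl)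

insert-remove-fixed : ∀ {m} {i : Fin (Nat.suc m)} (τ : Permutation′ (Nat.suc m)) →
                      τ ⟨$⟩ʳ i ≡ i → ∀ k → insert i i (remove i τ) ⟨$⟩ʳ k ≡ τ ⟨$⟩ʳ k
insert-remove-fixed {i = i} τ τi≡i =
  ≡.subst (λ j → ∀ k → insert i j (remove i τ) ⟨$⟩ʳ k ≡ τ ⟨$⟩ʳ k) τi≡i (Perm.insert-remove i τ)

-- The ordering [ρ(1) ⋯ ρ(m) m+1] of the paper.
appendLast : ∀ {m} → Permutation′ m → Permutation′ (Nat.suc m)
appendLast {m} ρ = insert (fromℕ m) (fromℕ m) ρ

appendLast-last : ∀ {m} (ρ : Permutation′ m) → appendLast ρ ⟨$⟩ʳ fromℕ m ≡ fromℕ m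
appendLast-last {m} = insert-self (fromℕ m) (fromℕ m)

appendLast-inject₁ : ∀ {m} (ρ : Permutation′ m) k → appendLast ρ ⟨$⟩ʳ inject₁ k ≡ inject₁ (ρ ⟨$⟩ʳ k)
appendLast-inject₁ {m} ρ k = begin
  appendLast ρ ⟨$⟩ʳ inject₁ k             ≡⟨ ≡.cong (appendLast ρ ⟨$⟩ʳ_) (punchIn-fromℕ k) ⟨
  appendLast ρ ⟨$⟩ʳ punchIn (fromℕ m) k   ≡⟨ Perm.insert-punchIn (fromℕ m) (fromℕ m) ρ k ⟩
  punchIn (fromℕ m) (ρ ⟨$⟩ʳ k)            ≡⟨ punchIn-fromℕ (ρ ⟨$⟩ʳ k) ⟩
  inject₁ (ρ ⟨$⟩ʳ k)                      ∎
  where open ≡.≡-Reasoning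

-- rotate m ∘ₚ τ moves the last element of the ordering τ to the front.
rotate : ∀ m → Permutation′ (Nat.suc m)
rotate m = insert zero (fromℕ m) Perm.id

rotate-zero : ∀ m → rotate m ⟨$⟩ʳ zero ≡ fromℕ m
rotate-zero m = insert-self zero (fromℕ m) Perm.id

rotate-suc : ∀ {m} (k : Fin m) → rotate m ⟨$⟩ʳ suc k ≡ inject₁ k
rotate-suc {m} k = ≡.trans (Perm.insert-punchIn zero (fromℕ m) Perm.id k) (punchIn-fromℕ k)

rotate⁻¹-inject₁ : ∀ {m} (k : Fin m) → rotate m ⟨$⟩ˡ inject₁ k ≡ suc k
rotate⁻¹-inject₁ {m} k =
  ≡.trans (≡.cong (rotate m ⟨$⟩ˡ_) (≡.sym (rotate-suc k))) (Perm.inverseˡ (rotate m))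

module _ {c ℓ₁ ℓ₂} (R : OrderedCommutativeRing c ℓ₁ ℓ₂) where

  open OrderedCommutativeRing R hiding (zero; _≤_)
  open LOP R
  open import Algebra.Properties.CommutativeMonoid.Sum +-commutativeMonoid
    using (sum-cong-≋; sum-cong-≗; sum-replicate-zero; sum-init-last; ∑-distrib-+; ∑-comm; sum-permute)
  open import Algebra.Properties.AbelianGroup +-abelianGroup
    using (ε⁻¹≈ε; ⁻¹-∙-comm; ⁻¹-anti-homo‿-; xyx⁻¹≈y; ∙-cancelʳ)
  open import Relation.Binary.Reasoning.Setoid setoid
  open IsTotalOrder isTotalOrder using (≤-respˡ-≈; ≤-respʳ-≈)

  ∑-zero : ∀ {n} {f : Fin n → Carrier} → (∀ k → f k ≈ 0#) → ∑ f ≈ 0#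
  ∑-zero {n} f≈0 = trans (sum-cong-≋ f≈0) (sum-replicate-zero n)

  ∑-neg : ∀ {n} (f : Fin n → Carrier) → ∑ (λ k → - f k) ≈ - ∑ f
  ∑-neg {Nat.zero}  f = sym ε⁻¹≈ε
  ∑-neg {Nat.suc n} f = trans (+-congˡ (∑-neg (λ k → f (suc k)))) (⁻¹-∙-comm _ _)

  ∑-sub : ∀ {n} (f g : Fin n → Carrier) → ∑ (λ k → f k - g k) ≈ ∑ f - ∑ g
  ∑-sub f g = trans (∑-distrib-+ f (λ k → - g k)) (+-congˡ (∑-neg g))

  ∑∑-skew≈0 : ∀ {n} (B : Matrix n) → ∑ (λ i → ∑ (λ j → B i j - B j i)) ≈ 0#
  ∑∑-skew≈0 B = begin
    ∑ (λ i → ∑ (λ j → B i j - B j i))          ≈⟨ sum-cong-≋ (λ i → ∑-sub (B i) (λ j → B j i)) ⟩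
    ∑ (λ i → ∑ (B i) - ∑ (λ j → B j i))        ≈⟨ ∑-sub (λ i → ∑ (B i)) (λ i → ∑ (λ j → B j i)) ⟩
    ∑ (λ i → ∑ (B i)) - ∑ (λ i → ∑ (λ j → B j i)) ≈⟨ +-congˡ (-‿cong (∑-comm (λ i j → B j i))) ⟩
    ∑ (λ i → ∑ (B i)) - ∑ (λ j → ∑ (B j))      ≈⟨ -‿inverseʳ _ ⟩
    0#                                         ∎

  sum-permute-init-last : ∀ {m} (f : Fin (Nat.suc m) → Carrier) (τ : Permutation′ (Nat.suc m)) →
    ∑ f ≈ ∑ (λ k → f (τ ⟨$⟩ʳ inject₁ k)) + f (τ ⟨$⟩ʳ fromℕ m)
  sum-permute-init-last f τ = trans (sum-permute f τ) (sum-init-last (λ k → f (τ ⟨$⟩ʳ k)))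

  ifBefore : ∀ {n} → Fin n → Fin n → Carrier → Carrier
  ifBefore k l x = if ⌊ k <? l ⌋ then x else 0#

  ifBefore-< : ∀ {n} {k l : Fin n} x → toℕ k Nat.< toℕ l → ifBefore k l x ≡ x
  ifBefore-< {k = k} {l} x k<l with k <? l
  ... | yes _  = ≡.refl
  ... | no k≮l = ⊥-elim (k≮l k<l)

  ifBefore-≮ : ∀ {n} {k l : Fin n} x → ¬ toℕ k Nat.< toℕ l → ifBefore k l x ≡ 0#
  ifBefore-≮ {k = k} {l} x k≮l with k <? l
  ... | yes k<l = ⊥-elim (k≮l k<l)
  ... | no _    = ≡.refl

  ifBefore-resp : ∀ {n n′} {k l : Fin n} {k′ l′ : Fin n′} x →
    (toℕ k Nat.< toℕ l → toℕ k′ Nat.< toℕ l′) → (toℕ k′ Nat.< toℕ l′ → toℕ k Nat.< toℕ l) →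
    ifBefore k l x ≡ ifBefore k′ l′ x
  ifBefore-resp {k = k} {l} x to from with k <? l
  ... | yes k<l = ≡.sym (ifBefore-< x (to k<l))
  ... | no k≮l  = ≡.sym (ifBefore-≮ x (λ k′<l′ → k≮l (from k′<l′)))

  ifBefore-suc : ∀ {n} (k l : Fin n) x → ifBefore (suc k) (suc l) x ≡ ifBefore k l x
  ifBefore-suc k l x = ifBefore-resp x Nat.s<s⁻¹ Nat.s<s

  ifBefore-inject₁ : ∀ {n} (k l : Fin n) x → ifBefore (inject₁ k) (inject₁ l) x ≡ ifBefore k l x
  ifBefore-inject₁ k l x = ifBefore-resp x
    (≡.subst₂ Nat._<_ (Finₚ.toℕ-inject₁ k) (Finₚ.toℕ-inject₁ l))
    (≡.subst₂ Nat._<_ (≡.sym (Finₚ.toℕ-inject₁ k)) (≡.sym (Finₚ.toℕ-inject₁ l)))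

  ifBefore-inject₁-fromℕ : ∀ {n} (k : Fin n) x → ifBefore (inject₁ k) (fromℕ n) x ≡ x
  ifBefore-inject₁-fromℕ {n} k x =
    ifBefore-< x (≡.subst (toℕ (inject₁ k) Nat.<_) (≡.sym (Finₚ.toℕ-fromℕ n)) (Finₚ.inject₁ℕ< k))

  ifBefore-fromℕ : ∀ {n} (l : Fin (Nat.suc n)) x → ifBefore (fromℕ n) l x ≡ 0#
  ifBefore-fromℕ {n} l x = ifBefore-≮ x λ n<l →
    Natₚ.<-irrefl ≡.refl (Natₚ.<-≤-trans (≡.subst (Nat._< toℕ l) (Finₚ.toℕ-fromℕ n) n<l)
                                         (Natₚ.≤-pred (Finₚ.toℕ<n l)))

  -- lopFun B σ is definitionally orderedPairSum (λ k l → B (σ k) (σ l)).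
  orderedPairSum : ∀ {n} → (Fin n → Fin n → Carrier) → Carrier
  orderedPairSum G = ∑ λ k → ∑ λ l → ifBefore k l (G k l)

  orderedPairSum-cong : ∀ {n} {G H : Fin n → Fin n → Carrier} →
    (∀ k l → G k l ≡ H k l) → orderedPairSum G ≡ orderedPairSum H
  orderedPairSum-cong G≡H = sum-cong-≗ (λ k → sum-cong-≗ (λ l → ≡.cong (ifBefore k l) (G≡H k l)))

  orderedPairSum-suc : ∀ {n} (G : Fin (Nat.suc n) → Fin (Nat.suc n) → Carrier) →
    orderedPairSum G ≈ ∑ (λ l → G zero (suc l)) + orderedPairSum (λ k l → G (suc k) (suc l))
  orderedPairSum-suc G = +-cong (+-identityˡ _) (sum-cong-≋ λ k → trans (+-identityˡ _)
    (reflexive (sum-cong-≗ λ l → ifBefore-suc k l (G (suc k) (suc l)))))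

  orderedPairSum-init-last : ∀ {n} (G : Fin (Nat.suc n) → Fin (Nat.suc n) → Carrier) →
    orderedPairSum G ≈
      orderedPairSum (λ k l → G (inject₁ k) (inject₁ l)) + ∑ (λ k → G (inject₁ k) (fromℕ n))
  orderedPairSum-init-last {n} G = begin
    orderedPairSum G
      ≈⟨ sum-init-last (λ k → ∑ λ l → ifBefore k l (G k l)) ⟩
    ∑ (λ k → ∑ λ l → ifBefore (inject₁ k) l (G (inject₁ k) l)) + ∑ (λ l → ifBefore (fromℕ n) l (G (fromℕ n) l))
      ≈⟨ +-cong (sum-cong-≋ λ k → sum-init-last (λ l → ifBefore (inject₁ k) l (G (inject₁ k) l)))
                (∑-zero λ l → reflexive (ifBefore-fromℕ l (G (fromℕ n) l))) ⟩
    ∑ (λ k → inner k + edge k) + 0#  ≈⟨ +-identityʳ _ ⟩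
    ∑ (λ k → inner k + edge k)       ≈⟨ ∑-distrib-+ inner edge ⟩
    ∑ inner + ∑ edge
      ≡⟨ ≡.cong₂ _+_ (sum-cong-≗ λ k → sum-cong-≗ λ l → ifBefore-inject₁ k l (G′ k l))
                     (sum-cong-≗ λ k → ifBefore-inject₁-fromℕ k (g k)) ⟩
    orderedPairSum G′ + ∑ g
      ∎
    where
    G′ = λ k l → G (inject₁ k) (inject₁ l)
    g  = λ k → G (inject₁ k) (fromℕ n)
    inner = λ k → ∑ λ l → ifBefore (inject₁ k) (inject₁ l) (G′ k l)
    edge  = λ k → ifBefore (inject₁ k) (fromℕ n) (g k)

  lopFun-cong : ∀ {m} (B : Matrix m) {σ τ : Permutation′ m} →
    (∀ k → σ ⟨$⟩ʳ k ≡ τ ⟨$⟩ʳ k) → lopFun B σ ≡ lopFun B τ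
  lopFun-cong B σ≗τ = orderedPairSum-cong λ k l → ≡.cong₂ B (σ≗τ k) (σ≗τ l)

  Balanced : ∀ {n} → Matrix n → Set ℓ₁
  Balanced B = ∀ x → ∑ (B x) ≈ ∑ (λ j → B j x)

  -- Both sums contain the diagonal entry B x x once, which cancels.
  Balanced⇒row≈column : ∀ {m} (B : Matrix (Nat.suc m)) → Balanced B → (τ : Permutation′ (Nat.suc m)) →
    let x = τ ⟨$⟩ʳ fromℕ m in
    ∑ (λ k → B x (τ ⟨$⟩ʳ inject₁ k)) ≈ ∑ (λ k → B (τ ⟨$⟩ʳ inject₁ k) x)
  Balanced⇒row≈column {m} B bal τ = ∙-cancelʳ (B x x) _ _ (begin
    ∑ (λ k → B x (τ ⟨$⟩ʳ inject₁ k)) + B x x ≈⟨ sum-permute-init-last (B x) τ ⟨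
    ∑ (B x)                                   ≈⟨ bal x ⟩
    ∑ (λ j → B j x)                           ≈⟨ sum-permute-init-last (λ j → B j x) τ ⟩
    ∑ (λ k → B (τ ⟨$⟩ʳ inject₁ k) x) + B x x ∎)
    where x = τ ⟨$⟩ʳ fromℕ m

  Balanced⇒lopFun-rotate : ∀ {m} (B : Matrix (Nat.suc m)) → Balanced B → (τ : Permutation′ (Nat.suc m)) →
    lopFun B (rotate m ∘ₚ τ) ≈ lopFun B τ
  Balanced⇒lopFun-rotate {m} B bal τ = begin
    lopFun B (rotate m ∘ₚ τ)
      ≈⟨ orderedPairSum-suc (λ k l → B (p (rotate m ⟨$⟩ʳ k)) (p (rotate m ⟨$⟩ʳ l))) ⟩
    ∑ (λ l → B (p (rotate m ⟨$⟩ʳ zero)) (p (rotate m ⟨$⟩ʳ suc l)))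
      + orderedPairSum (λ k l → B (p (rotate m ⟨$⟩ʳ suc k)) (p (rotate m ⟨$⟩ʳ suc l)))
      ≡⟨ ≡.cong₂ _+_ (sum-cong-≗ λ l → ≡.cong₂ B (≡.cong p (rotate-zero m)) (≡.cong p (rotate-suc l)))
                     (orderedPairSum-cong λ k l → ≡.cong₂ B (≡.cong p (rotate-suc k)) (≡.cong p (rotate-suc l))) ⟩
    ∑ (λ l → B x (p (inject₁ l))) + inner ≈⟨ +-comm _ inner ⟩
    inner + ∑ (λ l → B x (p (inject₁ l))) ≈⟨ +-congˡ (Balanced⇒row≈column B bal τ) ⟩
    inner + ∑ (λ k → B (p (inject₁ k)) x) ≈⟨ orderedPairSum-init-last (λ k l → B (p k) (p l)) ⟨
    lopFun B τ                            ∎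
    where
    p     = τ ⟨$⟩ʳ_
    x     = p (fromℕ m)
    inner = orderedPairSum (λ k l → B (p (inject₁ k)) (p (inject₁ l)))

  -- Each rotation moves the element m one position to the right; d counts the
  -- rotations still needed to bring it to the last position.
  Balanced⇒lopFun-attainedAtAppendLast′ : ∀ {m} (B : Matrix (Nat.suc m)) → Balanced B →
    ∀ d (τ : Permutation′ (Nat.suc m)) {p} → τ ⟨$⟩ˡ fromℕ m ≡ p → toℕ p Nat.+ d ≡ m →
    ∃ λ ρ → lopFun B τ ≈ lopFun B (appendLast ρ)
  Balanced⇒lopFun-attainedAtAppendLast′ {m} B bal d τ {p} τ⁻¹m≡p p+d≡m with view p
  ... | ‵fromℕ = remove (fromℕ m) τ ,
      reflexive (lopFun-cong B {τ} {appendLast (remove (fromℕ m) τ)} (λ k → ≡.sym (insert-remove-fixed τ τm≡m k)))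
    where
    τm≡m : τ ⟨$⟩ʳ fromℕ m ≡ fromℕ m
    τm≡m = ≡.trans (≡.cong (τ ⟨$⟩ʳ_) (≡.sym τ⁻¹m≡p)) (Perm.inverseʳ τ)
  Balanced⇒lopFun-attainedAtAppendLast′ {m} B bal Nat.zero τ _ p+0≡m | ‵inject₁ j =
    ⊥-elim (Finₚ.toℕ-inject₁-≢ j (≡.sym (≡.trans (≡.sym (Natₚ.+-identityʳ (toℕ (inject₁ j)))) p+0≡m)))
  Balanced⇒lopFun-attainedAtAppendLast′ {m} B bal (Nat.suc d) τ τ⁻¹m≡p p+d≡m | ‵inject₁ j
    = map₂ (trans (sym (Balanced⇒lopFun-rotate B bal τ)))
           (Balanced⇒lopFun-attainedAtAppendLast′ B bal d (rotate m ∘ₚ τ) rotated-position shifted)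
    where
    rotated-position : (rotate m ∘ₚ τ) ⟨$⟩ˡ fromℕ m ≡ suc j
    rotated-position = ≡.trans (≡.cong (rotate m ⟨$⟩ˡ_) τ⁻¹m≡p) (rotate⁻¹-inject₁ j)
    shifted : toℕ (suc j) Nat.+ d ≡ m
    shifted = ≡.trans (≡.sym (Natₚ.+-suc (toℕ j) d))
                      (≡.trans (≡.cong (Nat._+ Nat.suc d) (≡.sym (Finₚ.toℕ-inject₁ j))) p+d≡m)

  Balanced⇒lopFun-attainedAtAppendLast : ∀ {m} (B : Matrix (Nat.suc m)) → Balanced B →
    ∀ τ → ∃ λ ρ → lopFun B τ ≈ lopFun B (appendLast ρ)
  Balanced⇒lopFun-attainedAtAppendLast {m} B bal τ =
    Balanced⇒lopFun-attainedAtAppendLast′ B bal (m Nat.∸ toℕ p) τ ≡.refl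
      (Natₚ.m+[n∸m]≡n (Natₚ.≤-pred (Finₚ.toℕ<n p)))
    where p = τ ⟨$⟩ˡ fromℕ m

  toOld-fromℕ : ∀ n → toOld (fromℕ n) ≡ nothing
  toOld-fromℕ Nat.zero    = ≡.refl
  toOld-fromℕ (Nat.suc n) = ≡.cong (Maybe.map suc) (toOld-fromℕ n)

  toOld-inject₁ : ∀ {n} (j : Fin n) → toOld (inject₁ j) ≡ Maybe.just j
  toOld-inject₁ zero    = ≡.refl
  toOld-inject₁ (suc j) = ≡.cong (Maybe.map suc) (toOld-inject₁ j)

  module _ {m} (A : Matrix m) where

    imbalance : Fin m → Carrier
    imbalance i = ∑ (λ j → A i j - A j i)

    extend-inject₁ : ∀ i j → extend A (inject₁ i) (inject₁ j) ≡ A i j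
    extend-inject₁ i j rewrite toOld-inject₁ i | toOld-inject₁ j = ≡.refl

    extend-inject₁-fromℕ : ∀ i → extend A (inject₁ i) (fromℕ m) ≡ - imbalance i
    extend-inject₁-fromℕ i rewrite toOld-inject₁ i | toOld-fromℕ m = ≡.refl

    extend-fromℕ : ∀ j → extend A (fromℕ m) j ≡ 0#
    extend-fromℕ j rewrite toOld-fromℕ m = ≡.refl

    ∑-imbalance : ∑ (λ i → - imbalance i) ≈ 0#
    ∑-imbalance = trans (∑-neg imbalance) (trans (-‿cong (∑∑-skew≈0 A)) ε⁻¹≈ε)

    extend-balanced : Balanced (extend A)
    extend-balanced x with view x
    ... | ‵fromℕ = begin
      ∑ (extend A (fromℕ m))                                     ≈⟨ ∑-zero (λ j → reflexive (extend-fromℕ j)) ⟩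
      0#                                                         ≈⟨ ∑-imbalance ⟨
      ∑ (λ i → - imbalance i)                                    ≈⟨ +-identityʳ _ ⟨
      ∑ (λ i → - imbalance i) + 0#                               ≡⟨ ≡.cong₂ _+_ (sum-cong-≗ extend-inject₁-fromℕ) (extend-fromℕ (fromℕ m)) ⟨
      ∑ (λ i → extend A (inject₁ i) (fromℕ m)) + extend A (fromℕ m) (fromℕ m)
        ≈⟨ sum-init-last (λ i → extend A i (fromℕ m)) ⟨
      ∑ (λ i → extend A i (fromℕ m))                             ∎
    ... | ‵inject₁ i = begin
      ∑ (extend A (inject₁ i))                                   ≈⟨ sum-init-last (extend A (inject₁ i)) ⟩
      ∑ (λ j → extend A (inject₁ i) (inject₁ j)) + extend A (inject₁ i) (fromℕ m)
        ≡⟨ ≡.cong₂ _+_ (sum-cong-≗ (extend-inject₁ i)) (extend-inject₁-fromℕ i) ⟩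
      ∑ (A i) - imbalance i                                      ≈⟨ +-congˡ (-‿cong (∑-sub (A i) (λ j → A j i))) ⟩
      ∑ (A i) - (∑ (A i) - ∑ (λ j → A j i))                      ≈⟨ +-congˡ (⁻¹-anti-homo‿- _ _) ⟩
      ∑ (A i) + (∑ (λ j → A j i) - ∑ (A i))                      ≈⟨ +-assoc _ _ _ ⟨
      ∑ (A i) + ∑ (λ j → A j i) - ∑ (A i)                        ≈⟨ xyx⁻¹≈y _ _ ⟩
      ∑ (λ j → A j i)                                            ≈⟨ +-identityʳ _ ⟨
      ∑ (λ j → A j i) + 0#
        ≡⟨ ≡.cong₂ _+_ (sum-cong-≗ λ j → extend-inject₁ j i) (extend-fromℕ (inject₁ i)) ⟨
      ∑ (λ j → extend A (inject₁ j) (inject₁ i)) + extend A (fromℕ m) (inject₁ i)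
        ≈⟨ sum-init-last (λ j → extend A j (inject₁ i)) ⟨
      ∑ (λ j → extend A j (inject₁ i))                           ∎

    lopFun-extend-appendLast : ∀ ρ → lopFun (extend A) (appendLast ρ) ≈ lopFun A ρ
    lopFun-extend-appendLast ρ = begin
      lopFun (extend A) (appendLast ρ)
        ≈⟨ orderedPairSum-init-last (λ k l → extend A (q k) (q l)) ⟩
      orderedPairSum (λ k l → extend A (q (inject₁ k)) (q (inject₁ l)))
        + ∑ (λ k → extend A (q (inject₁ k)) (q (fromℕ m)))
        ≡⟨ ≡.cong₂ _+_
             (orderedPairSum-cong λ k l →
               ≡.trans (≡.cong₂ (extend A) (appendLast-inject₁ ρ k) (appendLast-inject₁ ρ l)) (extend-inject₁ _ _))
             (sum-cong-≗ λ k →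
               ≡.trans (≡.cong₂ (extend A) (appendLast-inject₁ ρ k) (appendLast-last ρ)) (extend-inject₁-fromℕ _)) ⟩
      lopFun A ρ + ∑ (λ k → - imbalance (ρ ⟨$⟩ʳ k)) ≈⟨ +-congˡ (sum-permute _ ρ) ⟨
      lopFun A ρ + ∑ (λ i → - imbalance i)         ≈⟨ +-congˡ ∑-imbalance ⟩
      lopFun A ρ + 0#                              ≈⟨ +-identityʳ _ ⟩
      lopFun A ρ                                   ∎
      where q = appendLast ρ ⟨$⟩ʳ_

  isGlobalMax-transfer : ∀ {m n} {f : Permutation′ m → Carrier} {g : Permutation′ n → Carrier}
    (ι : Permutation′ n → Permutation′ m) → (∀ ρ → f (ι ρ) ≈ g ρ) →
    (∀ τ → ∃ λ ρ → f τ ≈ f (ι ρ)) → ∀ σ → IsGlobalMax f (ι σ) ⇔ IsGlobalMax g σ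
  isGlobalMax-transfer ι f∘ι≈g onImage σ = mk⇔
    (λ max τ → ≤-respʳ-≈ (f∘ι≈g σ) (≤-respˡ-≈ (f∘ι≈g τ) (max (ι τ))))
    (λ max τ → let ρ , fτ≈fιρ = onImage τ in
      ≤-respʳ-≈ (sym (f∘ι≈g σ)) (≤-respˡ-≈ (sym (trans fτ≈fιρ (f∘ι≈g ρ))) (max ρ)))

-- Neither 2 ≤ m nor the zero diagonal is needed: diagonal entries never enter an
-- LOP function.
proposition4 : ∀ {c ℓ₁ ℓ₂} (R : OrderedCommutativeRing c ℓ₁ ℓ₂) (m : ℕ) → 2 ≤ m →
    (A : LOP.Matrix R m) → (∀ i → OrderedCommutativeRing._≈_ R (A i i) (OrderedCommutativeRing.0# R)) →
    (σ : Permutation′ m) →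
    LOP.IsGlobalMax R (LOP.lopFun R (LOP.extend R A)) (insert (fromℕ m) (fromℕ m) σ)
    ⇔ LOP.IsGlobalMax R (LOP.lopFun R A) σ
proposition4 R m _ A _ = isGlobalMax-transfer R appendLast
  (lopFun-extend-appendLast R A)
  (Balanced⇒lopFun-attainedAtAppendLast R (LOP.extend R A) (extend-balanced R A))
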